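{- Let $\mathbf{T}\in\{0,1\}^{n\times\ell}$ be a matrix with $\delta(\mathbf{T})\le 3$ and $|\mathcal{T}_3|\ge 5$. Then there exist $j_1\ne j_2\in[\ell]$ such that: $T_1\subseteq\{j_1,j_2\}$ for each $T_1\in\mathcal{T}_1$; $T_2\cap\{j_1,j_2\}\ne\emptyset$ for each $T_2\in\mathcal{T}_2$; and $T_3\supseteq\{j_1,j_2\}$ for each $T_3\in\mathcal{T}_3$. Moreover, with $\mathcal{T}_2'=\{T_2\in\mathcal{T}_2 : j_1\in T_2,\ j_2\notin T_2\}$ and $\mathcal{T}_2''=\{T_2\in\mathcal{T}_2 : j_1\notin T_2,\ j_2\in T_2\}$, exactly one of the following holds: (a) $\mathcal{T}_2'=\emptyset$ or $\mathcal{T}_2''=\emptyset$; (b) $\mathcal{T}_2'=\{\{j_1,j_3\}\}$ and $\mathcal{T}_2''=\{\{j_2,j_3\}\}$ for some $j_3\in[\ell]$.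
   Context: For rows $u,w\in\{0,1\}^\ell$, $D(u,w)=\{j\in[\ell]:u[j]\ne w[j]\}$ and $d(u,w)=|D(u,w)|$. $\delta(\mathbf{T})=\max_{i\ne i'}d(\mathbf{T}[i],\mathbf{T}[i'])$, where $\mathbf{T}[i]$ is the $i$-th row. For $x\in\mathbb{N}$, $\mathcal{T}_x$ is the set (without duplicates) $\{D(\mathbf{T}[i],\mathbf{T}[n]) : i\in[n-1],\ d(\mathbf{T}[i],\mathbf{T}[n])=x\}$. -}

module Defs where

open import Data.Nat using (ℕ; suc; _≟_)
open import Data.Bool using (Bool; _xor_)
import Data.Bool as B
open import Data.Fin using (Fin; fromℕ; inject₁)
open import Data.Fin.Subset using (Subset; ∣_∣; _∈_; _∉_)
open import Data.Vec using (zipWith)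
open import Data.Vec.Properties using (≡-dec)
open import Data.List using (List; map; filter; deduplicate; allFin)
import Data.List.Membership.Propositional as LM
open import Data.Product using (_×_)
open import Relation.Binary.PropositionalEquality using (_≡_)
open import Relation.Nullary using (Dec)

-- A binary matrix with n = suc m rows and ℓ columns; a row is a 0/1 vector
-- of length ℓ, represented as Subset ℓ = Vec Bool ℓ (true = 1).
Matrix : ℕ → ℕ → Set
Matrix m ℓ = Fin (suc m) → Subset ℓ

D : ∀ {ℓ} → Subset ℓ → Subset ℓ → Subset ℓ
D u w = zipWith _xor_ u w

d : ∀ {ℓ} → Subset ℓ → Subset ℓ → ℕ
d u w = ∣ D u w ∣

_≟ₛ_ : ∀ {ℓ} (S S' : Subset ℓ) → Dec (S ≡ S')
_≟ₛ_ = ≡-dec B._≟_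

-- The last row T[n] (n = suc m) is T (fromℕ m); rows i ∈ [n-1] are T (inject₁ i), i : Fin m.
-- 𝒯 T x = { D(T[i],T[n]) : i ∈ [n-1], d(T[i],T[n]) = x }, as a duplicate-free list.
𝒯 : ∀ {m ℓ} → Matrix m ℓ → ℕ → List (Subset ℓ)
𝒯 {m} T x =
  deduplicate _≟ₛ_
    (filter (λ S → ∣ S ∣ ≟ x)
      (map (λ i → D (T (inject₁ i)) (T (fromℕ m))) (allFin m)))

𝒯₂′ : ∀ {m ℓ} → Matrix m ℓ → Fin ℓ → Fin ℓ → Subset ℓ → Set
𝒯₂′ T j₁ j₂ S = S LM.∈ 𝒯 T 2 × j₁ ∈ S × j₂ ∉ S

𝒯₂″ : ∀ {m ℓ} → Matrix m ℓ → Fin ℓ → Fin ℓ → Subset ℓ → Set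
𝒯₂″ T j₁ j₂ S = S LM.∈ 𝒯 T 2 × j₁ ∉ S × j₂ ∈ S

-- Write Dᵢ = D(T[i],T[n]).  Since D(Dᵢ,Dᵢ′) = D(T[i],T[i′]), the sets Dᵢ form a
-- family 𝓕 of subsets of [ℓ] with pairwise symmetric difference ≤ 3, and 𝒯ₓ
-- is the set of its members of size x.  Every step of the proof is then a
-- statement about the sizes of a few sets, which is where |A Δ B| ≤ 3 enters:
--  * two 3-sets in 𝓕 share ≥ 2 points; distinct 3-sets share ≤ 2 points;
--  * given five distinct 3-sets S₁,…,S₅ ∈ 𝓕, the core K = S₁ ∩ S₂ has exactly
--    two points j₁, j₂ and lies in every 3-set of 𝓕 (the sunflower step);
--  * a 1-set of 𝓕 lies in every 3-set, hence in K; a 2-set of 𝓕 meets K;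
--  * two 2-sets of 𝓕 intersect, which pins down 𝒯₂′ and 𝒯₂″ in case (b).
-- Each size statement is a linear inequality between cardinalities of Boolean
-- combinations of the sets involved.
module Submission where

open import Defs
open import Data.Bool using (Bool; true; false; _∧_; _∨_; not; _xor_; T)
open import Data.Bool.Properties using (T-∧)
open import Data.Nat using (ℕ; zero; suc; _+_; _*_; _≤_; _≤ᵇ_; _<ᵇ_; z≤n; s≤s; _≟_; _≤?_)
open import Data.Nat.Properties
  using (≤-reflexive; ≤-trans; +-mono-≤; *-monoʳ-≤; *-zeroʳ; <⇒≱; <ᵇ⇒<; ≤ᵇ⇒≤; ≰⇒>; ≮⇒≥)
open import Data.Nat.Tactic.RingSolver using (solve-∀)
open import Data.Vec using (Vec; []; _∷_; lookup; head; tail; zipWith)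
import Data.Vec as Vec
open import Data.Fin using (Fin; zero; suc; fromℕ; inject₁) renaming (_≟_ to _≟ᶠ_)
open import Data.Fin.Subset using (Subset; _∩_; _∪_; ∁; ∣_∣; ⁅_⁆; _⊆_; Nonempty; Empty)
open import Data.Product using (_×_; _,_; proj₁; proj₂; ∃-syntax)
open import Data.List using (List; []; _∷_)
open import Data.Unit using (⊤; tt)
open import Data.Empty using (⊥; ⊥-elim)
open import Function.Bundles using (Equivalence)
open import Relation.Binary.PropositionalEquality using (_≡_; _≢_; refl; sym; trans; cong; subst)

data Formula (k : ℕ) : Set where
  var : Fin k → Formula k
  _&_ _∥_ _⊕_ : Formula k → Formula k → Formula k
  ~_ : Formula k → Formula k

infixr 7 _&_
infixr 6 _∥_ _⊕_

⟦_⟧ᵇ : ∀ {k} → Formula k → Vec Bool k → Bool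
⟦ var i ⟧ᵇ v = lookup v i
⟦ e & f ⟧ᵇ v = ⟦ e ⟧ᵇ v ∧ ⟦ f ⟧ᵇ v
⟦ e ∥ f ⟧ᵇ v = ⟦ e ⟧ᵇ v ∨ ⟦ f ⟧ᵇ v
⟦ e ⊕ f ⟧ᵇ v = ⟦ e ⟧ᵇ v xor ⟦ f ⟧ᵇ v
⟦ ~ e ⟧ᵇ v = not (⟦ e ⟧ᵇ v)

⟦_⟧ˢ : ∀ {k ℓ} → Formula k → Vec (Subset ℓ) k → Subset ℓ
⟦ var i ⟧ˢ ρ = lookup ρ i
⟦ e & f ⟧ˢ ρ = ⟦ e ⟧ˢ ρ ∩ ⟦ f ⟧ˢ ρ
⟦ e ∥ f ⟧ˢ ρ = ⟦ e ⟧ˢ ρ ∪ ⟦ f ⟧ˢ ρ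
⟦ e ⊕ f ⟧ˢ ρ = zipWith _xor_ (⟦ e ⟧ˢ ρ) (⟦ f ⟧ˢ ρ)
⟦ ~ e ⟧ˢ ρ = ∁ (⟦ e ⟧ˢ ρ)

heads : ∀ {k ℓ} → Vec (Subset (suc ℓ)) k → Vec Bool k
heads = Vec.map head

tails : ∀ {k ℓ} → Vec (Subset (suc ℓ)) k → Vec (Subset ℓ) k
tails = Vec.map tail

lookup-∷ : ∀ {k ℓ} (ρ : Vec (Subset (suc ℓ)) k) i →
           lookup ρ i ≡ lookup (heads ρ) i ∷ lookup (tails ρ) i
lookup-∷ ((x ∷ xs) ∷ ρ) zero = refl
lookup-∷ (_ ∷ ρ) (suc i) = lookup-∷ ρ i

⟦⟧ˢ-∷ : ∀ {k ℓ} (e : Formula k) (ρ : Vec (Subset (suc ℓ)) k) →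
        ⟦ e ⟧ˢ ρ ≡ ⟦ e ⟧ᵇ (heads ρ) ∷ ⟦ e ⟧ˢ (tails ρ)
⟦⟧ˢ-∷ (var i) ρ = lookup-∷ ρ i
⟦⟧ˢ-∷ (e & f) ρ rewrite ⟦⟧ˢ-∷ e ρ | ⟦⟧ˢ-∷ f ρ = refl
⟦⟧ˢ-∷ (e ∥ f) ρ rewrite ⟦⟧ˢ-∷ e ρ | ⟦⟧ˢ-∷ f ρ = refl
⟦⟧ˢ-∷ (e ⊕ f) ρ rewrite ⟦⟧ˢ-∷ e ρ | ⟦⟧ˢ-∷ f ρ = refl
⟦⟧ˢ-∷ (~ e) ρ rewrite ⟦⟧ˢ-∷ e ρ = refl

[_] : Bool → ℕ
[ true ] = 1
[ false ] = 0

∣∷∣ : ∀ {ℓ} b (p : Subset ℓ) → ∣ b ∷ p ∣ ≡ [ b ] + ∣ p ∣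
∣∷∣ true p = refl
∣∷∣ false p = refl

∣[]∣ : (p : Subset 0) → ∣ p ∣ ≡ 0
∣[]∣ [] = refl

LinForm : ℕ → Set
LinForm k = List (ℕ × Formula k)

valᵇ : ∀ {k} → LinForm k → Vec Bool k → ℕ
valᵇ [] v = 0
valᵇ ((c , e) ∷ L) v = c * [ ⟦ e ⟧ᵇ v ] + valᵇ L v

valˢ : ∀ {k ℓ} → LinForm k → Vec (Subset ℓ) k → ℕ
valˢ [] ρ = 0
valˢ ((c , e) ∷ L) ρ = c * ∣ ⟦ e ⟧ˢ ρ ∣ + valˢ L ρ

valˢ-∷ : ∀ {k ℓ} (L : LinForm k) (ρ : Vec (Subset (suc ℓ)) k) →
         valˢ L ρ ≡ valᵇ L (heads ρ) + valˢ L (tails ρ)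
valˢ-∷ [] ρ = refl
valˢ-∷ ((c , e) ∷ L) ρ
  rewrite ⟦⟧ˢ-∷ e ρ | ∣∷∣ (⟦ e ⟧ᵇ (heads ρ)) (⟦ e ⟧ˢ (tails ρ)) | valˢ-∷ L ρ =
  regroup c _ _ _ _
  where
  regroup : ∀ c a p b q → c * (a + p) + (b + q) ≡ (c * a + b) + (c * p + q)
  regroup = solve-∀

valˢ-[] : ∀ {k} (L : LinForm k) (ρ : Vec (Subset 0) k) → valˢ L ρ ≡ 0
valˢ-[] [] ρ = refl
valˢ-[] ((c , e) ∷ L) ρ rewrite ∣[]∣ (⟦ e ⟧ˢ ρ) | valˢ-[] L ρ | *-zeroʳ c = refl

-- Venn principle: an inequality between linear forms that holds at every point
-- of Boolᵏ holds for every k-tuple of subsets (sum it over the columns).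
venn-≤ : ∀ {k} ℓ (L R : LinForm k) → (∀ v → valᵇ L v ≤ valᵇ R v) →
         (ρ : Vec (Subset ℓ) k) → valˢ L ρ ≤ valˢ R ρ
venn-≤ zero L R pointwise ρ rewrite valˢ-[] L ρ = z≤n
venn-≤ (suc ℓ) L R pointwise ρ rewrite valˢ-∷ L ρ | valˢ-∷ R ρ =
  +-mono-≤ (pointwise (heads ρ)) (venn-≤ ℓ L R pointwise (tails ρ))

everywhere : (k : ℕ) → (Vec Bool k → Bool) → Bool
everywhere zero f = f []
everywhere (suc k) f = everywhere k (λ v → f (true ∷ v)) ∧ everywhere k (λ v → f (false ∷ v))

everywhere-sound : ∀ k f → T (everywhere k f) → ∀ v → T (f v)
everywhere-sound zero f h [] = h
everywhere-sound (suc k) f h (true ∷ v) = everywhere-sound k _ (proj₁ (Equivalence.to T-∧ h)) v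
everywhere-sound (suc k) f h (false ∷ v) = everywhere-sound k _ (proj₂ (Equivalence.to T-∧ h)) v

-- A bounded term (c , e , b) stands for c·|e| together with a bound b on |e|.
Bounded : ℕ → Set
Bounded k = ℕ × Formula k × ℕ

form : ∀ {k} → List (Bounded k) → LinForm k
form [] = []
form ((c , e , b) ∷ L) = (c , e) ∷ form L

bound : ∀ {k} → List (Bounded k) → ℕ
bound [] = 0
bound ((c , e , b) ∷ L) = c * b + bound L

Below : ∀ {k ℓ} → List (Bounded k) → Vec (Subset ℓ) k → Set
Below [] ρ = ⊤
Below ((c , e , b) ∷ L) ρ = b ≤ ∣ ⟦ e ⟧ˢ ρ ∣ × Below L ρ

Above : ∀ {k ℓ} → List (Bounded k) → Vec (Subset ℓ) k → Set
Above [] ρ = ⊤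
Above ((c , e , b) ∷ L) ρ = ∣ ⟦ e ⟧ˢ ρ ∣ ≤ b × Above L ρ

bound≤val : ∀ {k ℓ} (L : List (Bounded k)) (ρ : Vec (Subset ℓ) k) → Below L ρ → bound L ≤ valˢ (form L) ρ
bound≤val [] ρ h = z≤n
bound≤val ((c , e , b) ∷ L) ρ (p , h) = +-mono-≤ (*-monoʳ-≤ c p) (bound≤val L ρ h)

val≤bound : ∀ {k ℓ} (L : List (Bounded k)) (ρ : Vec (Subset ℓ) k) → Above L ρ → valˢ (form L) ρ ≤ bound L
val≤bound [] ρ h = z≤n
val≤bound ((c , e , b) ∷ L) ρ (p , h) = +-mono-≤ (*-monoʳ-≤ c p) (val≤bound L ρ h)

Dominated : ∀ {k} → List (Bounded k) → List (Bounded k) → Bool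
Dominated {k} L R = everywhere k (λ v → valᵇ (form L) v ≤ᵇ valᵇ (form R) v)

refute : ∀ {k ℓ} (ρ : Vec (Subset ℓ) k) (L R : List (Bounded k)) → T (Dominated L R) →
         Below L ρ → Above R ρ → T (bound R <ᵇ bound L) → ⊥
refute {k} {ℓ} ρ L R dominated below above gap =
  <⇒≱ (<ᵇ⇒< _ _ gap)
    (≤-trans (bound≤val L ρ below)
      (≤-trans (venn-≤ ℓ (form L) (form R) (λ v → ≤ᵇ⇒≤ _ _ (everywhere-sound k _ dominated v)) ρ)
        (val≤bound R ρ above)))

-- Everything about subsets of Fin ℓ lives in this module, where _∈_ is
-- membership of a point in a subset.
module SetSystems where

  open import Data.Fin using (#_)
  open import Data.Fin.Subset using (_∈_; _∉_)
  open import Data.Fin.Subset.Properties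
    using (_∈?_; nonempty?; Empty-unique; ∣⊥∣≡0; p⊆q⇒∣p∣≤∣q∣; x∈⁅x⁆; x∈⁅y⁆⇒x≡y; x≢y⇒x∉⁅y⁆;
           ∣⁅x⁆∣≡1; x∈p∩q⁺; x∈p∩q⁻; x∈∁p⇒x∉p)
  open import Relation.Nullary using (yes; no)
  open import Relation.Binary.PropositionalEquality using (cong₂; ≢-sym)

  ∈⇒∣∣≥1 : ∀ {ℓ} {x : Fin ℓ} {X : Subset ℓ} → x ∈ X → 1 ≤ ∣ X ∣
  ∈⇒∣∣≥1 {x = x} {X} x∈X =
    subst (_≤ ∣ X ∣) (∣⁅x⁆∣≡1 x)
      (p⊆q⇒∣p∣≤∣q∣ (λ y∈⁅x⁆ → subst (_∈ X) (sym (x∈⁅y⁆⇒x≡y x y∈⁅x⁆)) x∈X))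

  Empty⇒∣∣≤0 : ∀ {ℓ} {X : Subset ℓ} → Empty X → ∣ X ∣ ≤ 0
  Empty⇒∣∣≤0 {ℓ} empty rewrite Empty-unique empty = ≤-reflexive (∣⊥∣≡0 ℓ)

  ∣∣≥1⇒Nonempty : ∀ {ℓ} (X : Subset ℓ) → 1 ≤ ∣ X ∣ → Nonempty X
  ∣∣≥1⇒Nonempty X size with nonempty? X
  ... | yes nonempty = nonempty
  ... | no empty = ⊥-elim (<⇒≱ size (Empty⇒∣∣≤0 empty))

  ∈⇒∣⁅⁆∩∣≥1 : ∀ {ℓ} {x : Fin ℓ} {X : Subset ℓ} → x ∈ X → 1 ≤ ∣ ⁅ x ⁆ ∩ X ∣
  ∈⇒∣⁅⁆∩∣≥1 {x = x} x∈X = ∈⇒∣∣≥1 (x∈p∩q⁺ (x∈⁅x⁆ x , x∈X))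

  ∉⇒∣⁅⁆∩∣≤0 : ∀ {ℓ} {x : Fin ℓ} {X : Subset ℓ} → x ∉ X → ∣ ⁅ x ⁆ ∩ X ∣ ≤ 0
  ∉⇒∣⁅⁆∩∣≤0 {x = x} {X} x∉X = Empty⇒∣∣≤0 λ (y , y∈) →
    let (y∈⁅x⁆ , y∈X) = x∈p∩q⁻ ⁅ x ⁆ X y∈ in x∉X (subst (_∈ X) (x∈⁅y⁆⇒x≡y x y∈⁅x⁆) y∈X)

  ∣⁅⁆∣≤1 : ∀ {ℓ} (x : Fin ℓ) → ∣ ⁅ x ⁆ ∣ ≤ 1
  ∣⁅⁆∣≤1 x = ≤-reflexive (∣⁅x⁆∣≡1 x)

  d≤0⇒≡ : ∀ {ℓ} (A B : Subset ℓ) → d A B ≤ 0 → A ≡ B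
  d≤0⇒≡ [] [] _ = refl
  d≤0⇒≡ (true ∷ A) (true ∷ B) h = cong (true ∷_) (d≤0⇒≡ A B h)
  d≤0⇒≡ (false ∷ A) (false ∷ B) h = cong (false ∷_) (d≤0⇒≡ A B h)
  d≤0⇒≡ (true ∷ A) (false ∷ B) ()
  d≤0⇒≡ (false ∷ A) (true ∷ B) ()

  d≡0 : ∀ {ℓ} (A : Subset ℓ) → d A A ≡ 0
  d≡0 [] = refl
  d≡0 (true ∷ A) = d≡0 A
  d≡0 (false ∷ A) = d≡0 A

  D-cancel : ∀ {ℓ} (a b u : Subset ℓ) → D (D a u) (D b u) ≡ D a b
  D-cancel [] [] [] = refl
  D-cancel (x ∷ a) (y ∷ b) (z ∷ u) = cong₂ _∷_ (xor-cancel x y z) (D-cancel a b u)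
    where
    xor-cancel : ∀ x y z → (x xor z) xor (y xor z) ≡ x xor y
    xor-cancel true true true = refl
    xor-cancel true true false = refl
    xor-cancel true false true = refl
    xor-cancel true false false = refl
    xor-cancel false true true = refl
    xor-cancel false true false = refl
    xor-cancel false false true = refl
    xor-cancel false false false = refl

  ≢⇒d≥1 : ∀ {ℓ} {A B : Subset ℓ} → A ≢ B → 1 ≤ d A B
  ≢⇒d≥1 {A = A} {B} A≢B = ≰⇒> λ d≤0 → A≢B (d≤0⇒≡ A B d≤0)

  -- Since |A Δ B| = |A| + |B| − 2|A ∩ B|, close 3-sets share at least two points …
  close-triples-share-two : ∀ {ℓ} {A B : Subset ℓ} →
    ∣ A ∣ ≡ 3 → ∣ B ∣ ≡ 3 → d A B ≤ 3 → 2 ≤ ∣ A ∩ B ∣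
  close-triples-share-two {A = A} {B} ∣A∣ ∣B∣ dAB = ≰⇒> λ ∣A∩B∣≤1 →
    refute (A ∷ B ∷ []) ((1 , a , 3) ∷ (1 , b , 3) ∷ []) ((1 , a ⊕ b , 3) ∷ (2 , a & b , 1) ∷ []) tt
      (≤-reflexive (sym ∣A∣) , ≤-reflexive (sym ∣B∣) , tt) (dAB , ∣A∩B∣≤1 , tt) tt
    where a b : Formula 2
          a = var (# 0)
          b = var (# 1)

  distinct-triples-share-≤2 : ∀ {ℓ} {A B : Subset ℓ} →
    ∣ A ∣ ≡ 3 → ∣ B ∣ ≡ 3 → A ≢ B → ∣ A ∩ B ∣ ≤ 2
  distinct-triples-share-≤2 {A = A} {B} ∣A∣ ∣B∣ A≢B = ≮⇒≥ λ ∣A∩B∣≥3 →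
    refute (A ∷ B ∷ []) ((1 , a ⊕ b , 1) ∷ (2 , a & b , 3) ∷ []) ((1 , a , 3) ∷ (1 , b , 3) ∷ []) tt
      (≢⇒d≥1 A≢B , ∣A∩B∣≥3 , tt) (≤-reflexive ∣A∣ , ≤-reflexive ∣B∣ , tt) tt
    where a b : Formula 2
          a = var (# 0)
          b = var (# 1)

  other-point : ∀ {ℓ} {X : Subset ℓ} {x : Fin ℓ} → 2 ≤ ∣ X ∣ → ∃[ y ] (y ∈ X × y ≢ x)
  other-point {X = X} {x} ∣X∣≥2
    with ∣∣≥1⇒Nonempty (X ∩ ∁ ⁅ x ⁆) (≰⇒> λ ∣X-x∣≤0 →
           refute (X ∷ ⁅ x ⁆ ∷ []) ((1 , a , 2) ∷ []) ((1 , a & ~ b , 0) ∷ (1 , b , 1) ∷ []) tt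
             (∣X∣≥2 , tt) (∣X-x∣≤0 , ∣⁅⁆∣≤1 x , tt) tt)
    where a b : Formula 2
          a = var (# 0)
          b = var (# 1)
  ... | y , y∈X-x = y , proj₁ (x∈p∩q⁻ X _ y∈X-x) ,
        λ y≡x → x∈∁p⇒x∉p (proj₂ (x∈p∩q⁻ X _ y∈X-x)) (subst (_∈ ⁅ x ⁆) (sym y≡x) (x∈⁅x⁆ x))

  pair-≡ : ∀ {ℓ} {V : Subset ℓ} {p q : Fin ℓ} →
    ∣ V ∣ ≤ 2 → p ∈ V → q ∈ V → p ≢ q → V ≡ ⁅ p ⁆ ∪ ⁅ q ⁆
  pair-≡ {V = V} {p} {q} ∣V∣≤2 p∈V q∈V p≢q = d≤0⇒≡ V _ (≮⇒≥ λ dV≥1 →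
    refute (V ∷ ⁅ p ⁆ ∷ ⁅ q ⁆ ∷ [])
      ((1 , v ⊕ (x ∥ y) , 1) ∷ (2 , x & v , 1) ∷ (2 , y & v , 1) ∷ [])
      ((1 , v , 2) ∷ (1 , x , 1) ∷ (1 , y , 1) ∷ (2 , x & y , 0) ∷ []) tt
      (dV≥1 , ∈⇒∣⁅⁆∩∣≥1 p∈V , ∈⇒∣⁅⁆∩∣≥1 q∈V , tt)
      (∣V∣≤2 , ∣⁅⁆∣≤1 p , ∣⁅⁆∣≤1 q , ∉⇒∣⁅⁆∩∣≤0 (x≢y⇒x∉⁅y⁆ p≢q) , tt) tt)
    where v x y : Formula 3
          v = var (# 0)
          x = var (# 1)
          y = var (# 2)

  -- A point at distance ≤ 3 from a 3-set lies in it (|S Δ C| = 4 − 2|S ∩ C|).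
  singleton⊆close-triple : ∀ {ℓ} {S C : Subset ℓ} →
    ∣ S ∣ ≡ 1 → ∣ C ∣ ≡ 3 → d S C ≤ 3 → S ⊆ C
  singleton⊆close-triple {S = S} {C} ∣S∣ ∣C∣ dSC {z} z∈S with z ∈? C
  ... | yes z∈C = z∈C
  ... | no z∉C = ⊥-elim (refute (S ∷ C ∷ ⁅ z ⁆ ∷ [])
        ((1 , s , 1) ∷ (1 , c , 3) ∷ (2 , x & s , 1) ∷ [])
        ((1 , s ⊕ c , 3) ∷ (2 , x & c , 0) ∷ (2 , s , 1) ∷ []) tt
        (≤-reflexive (sym ∣S∣) , ≤-reflexive (sym ∣C∣) , ∈⇒∣⁅⁆∩∣≥1 z∈S , tt)
        (dSC , ∉⇒∣⁅⁆∩∣≤0 z∉C , ≤-reflexive ∣S∣ , tt) tt)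
    where s c x : Formula 3
          s = var (# 0)
          c = var (# 1)
          x = var (# 2)

  -- Two 2-sets at distance ≤ 3 intersect; so if p, q are the points of U and
  -- p ∉ V, then q ∈ V.
  close-pairs-meet : ∀ {ℓ} {U V : Subset ℓ} {p q : Fin ℓ} →
    ∣ U ∣ ≡ 2 → ∣ V ∣ ≡ 2 → d U V ≤ 3 → p ∈ U → q ∈ U → p ≢ q → p ∉ V → q ∈ V
  close-pairs-meet {U = U} {V} {p} {q} ∣U∣ ∣V∣ dUV p∈U q∈U p≢q p∉V with q ∈? V
  ... | yes q∈V = q∈V
  ... | no q∉V = ⊥-elim (refute (U ∷ V ∷ ⁅ p ⁆ ∷ ⁅ q ⁆ ∷ [])
        ((1 , u , 2) ∷ (1 , v , 2) ∷ (2 , x & u , 1) ∷ (2 , y & u , 1) ∷ [])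
        ((1 , u ⊕ v , 3) ∷ (2 , u , 2) ∷ (2 , x & v , 0) ∷ (2 , y & v , 0) ∷ (2 , x & y , 0) ∷ []) tt
        (≤-reflexive (sym ∣U∣) , ≤-reflexive (sym ∣V∣) , ∈⇒∣⁅⁆∩∣≥1 p∈U , ∈⇒∣⁅⁆∩∣≥1 q∈U , tt)
        (dUV , ≤-reflexive ∣U∣ , ∉⇒∣⁅⁆∩∣≤0 p∉V , ∉⇒∣⁅⁆∩∣≤0 q∉V , ∉⇒∣⁅⁆∩∣≤0 (x≢y⇒x∉⁅y⁆ p≢q) , tt) tt)
    where u v x y : Formula 4
          u = var (# 0)
          v = var (# 1)
          x = var (# 2)
          y = var (# 3)

  large-trace⇒⊆ : ∀ {ℓ} {K C : Subset ℓ} → ∣ K ∣ ≤ 2 → 2 ≤ ∣ K ∩ C ∣ → K ⊆ C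
  large-trace⇒⊆ {K = K} {C} ∣K∣≤2 ∣K∩C∣≥2 {z} z∈K with z ∈? C
  ... | yes z∈C = z∈C
  ... | no z∉C = ⊥-elim (refute (K ∷ C ∷ ⁅ z ⁆ ∷ [])
        ((1 , k & c , 2) ∷ (1 , x & k , 1) ∷ []) ((1 , k , 2) ∷ (1 , x & c , 0) ∷ []) tt
        (∣K∩C∣≥2 , ∈⇒∣⁅⁆∩∣≥1 z∈K , tt) (∣K∣≤2 , ∉⇒∣⁅⁆∩∣≤0 z∉C , tt) tt)
    where k c x : Formula 3
          k = var (# 0)
          c = var (# 1)
          x = var (# 2)

  module CloseFamily {ℓ : ℕ} (𝓕 : Subset ℓ → Set)
                     (close : ∀ {S S′} → 𝓕 S → 𝓕 S′ → d S S′ ≤ 3) where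

    Member : ℕ → Subset ℓ → Set
    Member n S = 𝓕 S × ∣ S ∣ ≡ n

    Triple : Subset ℓ → Set
    Triple = Member 3

    share-two : ∀ {A B} → Triple A → Triple B → 2 ≤ ∣ A ∩ B ∣
    share-two {A} {B} (fA , ∣A∣) (fB , ∣B∣) = close-triples-share-two {A = A} {B} ∣A∣ ∣B∣ (close fA fB)

    share-≤2 : ∀ {A B} → Triple A → Triple B → A ≢ B → ∣ A ∩ B ∣ ≤ 2
    share-≤2 {A} {B} (_ , ∣A∣) (_ , ∣B∣) = distinct-triples-share-≤2 {A = A} {B} ∣A∣ ∣B∣

    size≥ : ∀ {n S} → Member n S → n ≤ ∣ S ∣
    size≥ (_ , ∣S∣) = ≤-reflexive (sym ∣S∣)

    size≤ : ∀ {n S} → Member n S → ∣ S ∣ ≤ n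
    size≤ (_ , ∣S∣) = ≤-reflexive ∣S∣

    pairs-meet : ∀ {U V p q} → Member 2 U → Member 2 V → p ∈ U → q ∈ U → p ≢ q → p ∉ V → q ∈ V
    pairs-meet {U} {V} (fU , ∣U∣) (fV , ∣V∣) = close-pairs-meet {U = U} {V} ∣U∣ ∣V∣ (close fU fV)

    crossing-pairs : ∀ {j₁ j₂ S′ S″} →
      Member 2 S′ → j₁ ∈ S′ → j₂ ∉ S′ → Member 2 S″ → j₁ ∉ S″ → j₂ ∈ S″ →
      ∃[ j₃ ] ((∀ {S} → Member 2 S → j₁ ∈ S → j₂ ∉ S → S ≡ ⁅ j₁ ⁆ ∪ ⁅ j₃ ⁆)
             × (∀ {S} → Member 2 S → j₁ ∉ S → j₂ ∈ S → S ≡ ⁅ j₂ ⁆ ∪ ⁅ j₃ ⁆))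
    crossing-pairs {j₁} {j₂} {S′} {S″} m′ j₁∈S′ j₂∉S′ m″ j₁∉S″ j₂∈S″
      with other-point {x = j₁} (size≥ m′)
    ... | j₃ , j₃∈S′ , j₃≢j₁ = j₃ , with-j₁ , with-j₂
      where
      j₃≢j₂ : j₃ ≢ j₂
      j₃≢j₂ j₃≡j₂ = j₂∉S′ (subst (_∈ S′) j₃≡j₂ j₃∈S′)

      j₃∈S″ : j₃ ∈ S″
      j₃∈S″ = pairs-meet m′ m″ j₁∈S′ j₃∈S′ (≢-sym j₃≢j₁) j₁∉S″

      with-j₁ : ∀ {S} → Member 2 S → j₁ ∈ S → j₂ ∉ S → S ≡ ⁅ j₁ ⁆ ∪ ⁅ j₃ ⁆
      with-j₁ m j₁∈S j₂∉S =
        pair-≡ (size≤ m) j₁∈S (pairs-meet m″ m j₂∈S″ j₃∈S″ (≢-sym j₃≢j₂) j₂∉S) (≢-sym j₃≢j₁)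

      with-j₂ : ∀ {S} → Member 2 S → j₁ ∉ S → j₂ ∈ S → S ≡ ⁅ j₂ ⁆ ∪ ⁅ j₃ ⁆
      with-j₂ m j₁∉S j₂∈S =
        pair-≡ (size≤ m) j₂∈S (pairs-meet m′ m j₁∈S′ j₃∈S′ (≢-sym j₃≢j₁) j₁∉S) (≢-sym j₃≢j₂)

    module Core {A B : Subset ℓ} (tA : Triple A) (tB : Triple B) (A≢B : A ≢ B) where

      K : Subset ℓ
      K = A ∩ B

      ∣K∣≤2 : ∣ K ∣ ≤ 2
      ∣K∣≤2 = share-≤2 tA tB A≢B

      -- If one further triple E contains K, every triple C does: C meets each
      -- of A, B, E in ≥ 2 points, while A ∩ E and B ∩ E have ≤ 2 points.
      spread : ∀ {E C} → Triple E → E ≢ A → E ≢ B → 2 ≤ ∣ K ∩ E ∣ → Triple C → 2 ≤ ∣ K ∩ C ∣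
      spread {E} {C} tE E≢A E≢B ∣K∩E∣ tC = ≰⇒> λ ∣K∩C∣≤1 →
        refute (A ∷ B ∷ C ∷ E ∷ [])
          ((1 , c & e , 2) ∷ (1 , a & c , 2) ∷ (1 , b & c , 2) ∷ (2 , (a & b) & e , 2) ∷ [])
          ((2 , (a & b) & c , 1) ∷ (1 , c , 3) ∷ (1 , a & e , 2) ∷ (1 , b & e , 2) ∷ []) tt
          (share-two tC tE , share-two tA tC , share-two tB tC , ∣K∩E∣ , tt)
          (∣K∩C∣≤1 , size≤ tC , share-≤2 tA tE (≢-sym E≢A) , share-≤2 tB tE (≢-sym E≢B) , tt) tt
        where a b c e : Formula 4
              a = var (# 0)
              b = var (# 1)
              c = var (# 2)
              e = var (# 3)

      AΔB⊆ : ∀ {C} → Triple C → ∣ K ∩ C ∣ ≤ 1 → ∣ D A B ∩ ∁ C ∣ ≤ 0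
      AΔB⊆ {C} tC ∣K∩C∣≤1 = ≮⇒≥ λ ∣AΔB-C∣≥1 →
        refute (A ∷ B ∷ C ∷ [])
          ((1 , (a ⊕ b) & ~ c , 1) ∷ (1 , a & c , 2) ∷ (1 , b & c , 2) ∷ (2 , a & b , 2) ∷ [])
          ((1 , a , 3) ∷ (1 , b , 3) ∷ (2 , (a & b) & c , 1) ∷ []) tt
          (∣AΔB-C∣≥1 , share-two tA tC , share-two tB tC , share-two tA tB , tt)
          (size≤ tA , size≤ tB , ∣K∩C∣≤1 , tt) tt
        where a b c : Formula 3
              a = var (# 0)
              b = var (# 1)
              c = var (# 2)

      disjoint-on-K : ∀ {C E} → Triple C → Triple E → C ≢ E →
        ∣ D A B ∩ ∁ C ∣ ≤ 0 → ∣ D A B ∩ ∁ E ∣ ≤ 0 → ∣ K ∩ (C ∩ E) ∣ ≤ 0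
      disjoint-on-K {C} {E} tC tE C≢E AΔB⊆C AΔB⊆E = ≮⇒≥ λ ∣K∩C∩E∣≥1 →
        refute (A ∷ B ∷ C ∷ E ∷ [])
          ((1 , (a & b) & c & e , 1) ∷ (1 , a , 3) ∷ (1 , b , 3) ∷ [])
          ((1 , c & e , 2) ∷ (1 , (a ⊕ b) & ~ c , 0) ∷ (1 , (a ⊕ b) & ~ e , 0) ∷ (2 , a & b , 2) ∷ []) tt
          (∣K∩C∩E∣≥1 , size≥ tA , size≥ tB , tt)
          (share-≤2 tC tE C≢E , AΔB⊆C , AΔB⊆E , ∣K∣≤2 , tt) tt
        where a b c e : Formula 4
              a = var (# 0)
              b = var (# 1)
              c = var (# 2)
              e = var (# 3)

      -- Three distinct triples cannot all meet K in at most one point: each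
      -- would meet A and B in two points, which the lemmas above rule out.
      no-three-sparse : ∀ {C E F} → Triple C → Triple E → Triple F → C ≢ E → C ≢ F → E ≢ F →
        ∣ K ∩ C ∣ ≤ 1 → ∣ K ∩ E ∣ ≤ 1 → ∣ K ∩ F ∣ ≤ 1 → ⊥
      no-three-sparse {C} {E} {F} tC tE tF C≢E C≢F E≢F sC sE sF =
        refute (A ∷ B ∷ C ∷ E ∷ F ∷ [])
          ((1 , a & c , 2) ∷ (1 , b & c , 2) ∷ (1 , a & e , 2) ∷ (1 , b & e , 2) ∷
           (1 , a & f , 2) ∷ (1 , b & f , 2) ∷ [])
          ((1 , c , 3) ∷ (1 , e , 3) ∷ (1 , f , 3) ∷ (1 , a & b , 2) ∷
           (1 , (a & b) & c & e , 0) ∷ (1 , (a & b) & c & f , 0) ∷ (1 , (a & b) & e & f , 0) ∷ []) tt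
          (share-two tA tC , share-two tB tC , share-two tA tE , share-two tB tE ,
           share-two tA tF , share-two tB tF , tt)
          (size≤ tC , size≤ tE , size≤ tF , ∣K∣≤2 ,
           disjoint-on-K tC tE C≢E (AΔB⊆ tC sC) (AΔB⊆ tE sE) ,
           disjoint-on-K tC tF C≢F (AΔB⊆ tC sC) (AΔB⊆ tF sF) ,
           disjoint-on-K tE tF E≢F (AΔB⊆ tE sE) (AΔB⊆ tF sF) , tt) tt
        where a b c e f : Formula 5
              a = var (# 0)
              b = var (# 1)
              c = var (# 2)
              e = var (# 3)
              f = var (# 4)

    record FiveTriples : Set where
      field
        S₁ S₂ S₃ S₄ S₅ : Subset ℓ
        t₁ : Triple S₁
        t₂ : Triple S₂
        t₃ : Triple S₃
        t₄ : Triple S₄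
        t₅ : Triple S₅
        S₁≢S₂ : S₁ ≢ S₂
        S₁≢S₃ : S₁ ≢ S₃
        S₁≢S₄ : S₁ ≢ S₄
        S₁≢S₅ : S₁ ≢ S₅
        S₂≢S₃ : S₂ ≢ S₃
        S₂≢S₄ : S₂ ≢ S₄
        S₂≢S₅ : S₂ ≢ S₅
        S₃≢S₄ : S₃ ≢ S₄
        S₃≢S₅ : S₃ ≢ S₅
        S₄≢S₅ : S₄ ≢ S₅

    module Sunflower (F : FiveTriples) where
      open FiveTriples F
      open Core t₁ t₂ S₁≢S₂ public using (K)
      open Core t₁ t₂ S₁≢S₂ using (∣K∣≤2; spread; no-three-sparse)

      -- If one of S₃, S₄, S₅ meets K in two points, spread applies; if none
      -- does, no-three-sparse is contradicted.
      K⊆triple : ∀ {C} → Triple C → K ⊆ C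
      K⊆triple tC with 2 ≤? ∣ K ∩ S₃ ∣ | 2 ≤? ∣ K ∩ S₄ ∣ | 2 ≤? ∣ K ∩ S₅ ∣
      ... | yes dense | _ | _ = large-trace⇒⊆ ∣K∣≤2 (spread t₃ (≢-sym S₁≢S₃) (≢-sym S₂≢S₃) dense tC)
      ... | no _ | yes dense | _ = large-trace⇒⊆ ∣K∣≤2 (spread t₄ (≢-sym S₁≢S₄) (≢-sym S₂≢S₄) dense tC)
      ... | no _ | no _ | yes dense = large-trace⇒⊆ ∣K∣≤2 (spread t₅ (≢-sym S₁≢S₅) (≢-sym S₂≢S₅) dense tC)
      ... | no sparse₃ | no sparse₄ | no sparse₅ =
        ⊥-elim (no-three-sparse t₃ t₄ t₅ S₃≢S₄ S₃≢S₅ S₄≢S₅ (≮⇒≥ sparse₃) (≮⇒≥ sparse₄) (≮⇒≥ sparse₅))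

      K-is-pair : ∃[ j₁ ] ∃[ j₂ ] (j₁ ≢ j₂ × K ≡ ⁅ j₁ ⁆ ∪ ⁅ j₂ ⁆)
      K-is-pair with ∣∣≥1⇒Nonempty K (≤-trans (s≤s z≤n) (share-two t₁ t₂))
      ... | j₁ , j₁∈K with other-point {x = j₁} (share-two t₁ t₂)
      ... | j₂ , j₂∈K , j₂≢j₁ = j₁ , j₂ , ≢-sym j₂≢j₁ , pair-≡ ∣K∣≤2 j₁∈K j₂∈K (≢-sym j₂≢j₁)

      -- A 1-member lies in the triples S₁ and S₂, hence in K.
      singleton⊆K : ∀ {S} → Member 1 S → S ⊆ K
      singleton⊆K (fS , ∣S∣) z∈S =
        x∈p∩q⁺ (singleton⊆close-triple ∣S∣ (proj₂ t₁) (close fS (proj₁ t₁)) z∈S ,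
                singleton⊆close-triple ∣S∣ (proj₂ t₂) (close fS (proj₁ t₂)) z∈S)

      -- A 2-member S disjoint from K would have to meet each of S₃, S₄, S₅
      -- (distance ≤ 3) outside K, in three distinct points.
      pair-meets-K : ∀ {S} → Member 2 S → Nonempty (S ∩ K)
      pair-meets-K {S} mS@(fS , _) = ∣∣≥1⇒Nonempty (S ∩ K) (≰⇒> λ ∣S∩K∣≤0 →
        refute (S ∷ K ∷ S₃ ∷ S₄ ∷ S₅ ∷ [])
          ((3 , s , 2) ∷ (1 , c , 3) ∷ (1 , e , 3) ∷ (1 , f , 3) ∷
           (2 , k & c & e , 2) ∷ (2 , k & c & f , 2) ∷ (2 , k & e & f , 2) ∷ [])
          ((1 , s ⊕ c , 3) ∷ (1 , s ⊕ e , 3) ∷ (1 , s ⊕ f , 3) ∷ (6 , s & k , 0) ∷ (2 , s , 2) ∷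
           (2 , c & e , 2) ∷ (2 , c & f , 2) ∷ (2 , e & f , 2) ∷ []) tt
          (size≥ mS , size≥ t₃ , size≥ t₄ , size≥ t₅ ,
           K-in-both t₃ t₄ , K-in-both t₃ t₅ , K-in-both t₄ t₅ , tt)
          (close fS (proj₁ t₃) , close fS (proj₁ t₄) , close fS (proj₁ t₅) , ∣S∩K∣≤0 , size≤ mS ,
           share-≤2 t₃ t₄ S₃≢S₄ , share-≤2 t₃ t₅ S₃≢S₅ , share-≤2 t₄ t₅ S₄≢S₅ , tt) tt)
        where
        s k c e f : Formula 5
        s = var (# 0)
        k = var (# 1)
        c = var (# 2)
        e = var (# 3)
        f = var (# 4)

        K-in-both : ∀ {C E} → Triple C → Triple E → 2 ≤ ∣ K ∩ (C ∩ E) ∣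
        K-in-both tC tE = ≤-trans (share-two t₁ t₂)
          (p⊆q⇒∣p∣≤∣q∣ λ z∈K → x∈p∩q⁺ (z∈K , x∈p∩q⁺ (K⊆triple tC z∈K , K⊆triple tE z∈K)))

open SetSystems

open import Data.Fin.Properties using (inject₁-injective)
open import Data.Fin.Subset.Properties using (_∈?_)
open import Data.List using (length; map; filter; allFin)
open import Data.List.Membership.Propositional using (_∈_; find; lose)
open import Data.List.Membership.Propositional.Properties using (∈-deduplicate⁻; ∈-filter⁻; ∈-map⁻)
open import Data.List.Relation.Unary.All using (_∷_)
open import Data.List.Relation.Unary.Any using (here; there; any?)
open import Data.List.Relation.Unary.AllPairs using (_∷_)
open import Data.List.Relation.Unary.Unique.Propositional using (Unique)
open import Data.List.Relation.Unary.Unique.DecPropositional.Properties using (deduplicate-!)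
open import Data.Sum using (_⊎_; inj₁; inj₂)
open import Function using (_∘_)
open import Function.Bundles using (_⇔_; mk⇔)
open import Relation.Nullary using (¬_; yes; no; ¬?)
open import Relation.Nullary.Decidable using (_×-dec_)

only-instance : ∀ {ℓ} {P : Subset ℓ → Set} {S₀ X : Subset ℓ} →
  P S₀ → (∀ S → P S → S ≡ X) → ∀ S → P S ⇔ (S ≡ X)
only-instance {P = P} pS₀ all-X S =
  mk⇔ (all-X S) (λ S≡X → subst P (trans (all-X _ pS₀) (sym S≡X)) pS₀)

module RowDifferences {m ℓ : ℕ} (T : Matrix m ℓ)
    (rows-close : ∀ (i i′ : Fin (suc m)) → i ≢ i′ → d (T i) (T i′) ≤ 3) where

  IsDifference : Subset ℓ → Set
  IsDifference S = ∃[ i ] (S ≡ D (T (inject₁ i)) (T (fromℕ m)))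

  -- D(Dᵢ, Dᵢ′) = D(T[i], T[i′]), so the differences form a close family.
  differences-close : ∀ {S S′} → IsDifference S → IsDifference S′ → d S S′ ≤ 3
  differences-close (i , refl) (i′ , refl) with i ≟ᶠ i′
  ... | yes refl rewrite d≡0 (D (T (inject₁ i)) (T (fromℕ m))) = z≤n
  ... | no i≢i′ rewrite D-cancel (T (inject₁ i)) (T (inject₁ i′)) (T (fromℕ m)) =
    rows-close _ _ (i≢i′ ∘ inject₁-injective)

  open CloseFamily IsDifference differences-close public

  ∈𝒯⇒Member : ∀ {x S} → S ∈ 𝒯 T x → Member x S
  ∈𝒯⇒Member {x} {S} S∈𝒯
    with ∈-filter⁻ (λ S → ∣ S ∣ ≟ x) {xs = differences} (∈-deduplicate⁻ _≟ₛ_ (filter (λ S → ∣ S ∣ ≟ x) differences) S∈𝒯)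
    where differences = map (λ i → D (T (inject₁ i)) (T (fromℕ m))) (allFin m)
  ... | S∈differences , ∣S∣≡x with ∈-map⁻ (λ i → D (T (inject₁ i)) (T (fromℕ m))) S∈differences
  ... | i , _ , S≡Dᵢ = (i , S≡Dᵢ) , ∣S∣≡x

  five-triples : ∀ L → (∀ {S} → S ∈ L → Triple S) → Unique L → 5 ≤ length L → FiveTriples
  five-triples [] _ _ ()
  five-triples (_ ∷ []) _ _ (s≤s ())
  five-triples (_ ∷ _ ∷ []) _ _ (s≤s (s≤s ()))
  five-triples (_ ∷ _ ∷ _ ∷ []) _ _ (s≤s (s≤s (s≤s ())))
  five-triples (_ ∷ _ ∷ _ ∷ _ ∷ []) _ _ (s≤s (s≤s (s≤s (s≤s ()))))
  five-triples (A ∷ B ∷ C ∷ E ∷ F ∷ _) triple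
    ((A≢B ∷ A≢C ∷ A≢E ∷ A≢F ∷ _) ∷ (B≢C ∷ B≢E ∷ B≢F ∷ _) ∷ (C≢E ∷ C≢F ∷ _) ∷ (E≢F ∷ _) ∷ _) _ =
    record { S₁ = A ; S₂ = B ; S₃ = C ; S₄ = E ; S₅ = F
           ; t₁ = triple (here refl) ; t₂ = triple (there (here refl))
           ; t₃ = triple (there (there (here refl)))
           ; t₄ = triple (there (there (there (here refl))))
           ; t₅ = triple (there (there (there (there (here refl)))))
           ; S₁≢S₂ = A≢B ; S₁≢S₃ = A≢C ; S₁≢S₄ = A≢E ; S₁≢S₅ = A≢F ; S₂≢S₃ = B≢C
           ; S₂≢S₄ = B≢E ; S₂≢S₅ = B≢F ; S₃≢S₄ = C≢E ; S₃≢S₅ = C≢F ; S₄≢S₅ = E≢F }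

  CaseA : Fin ℓ → Fin ℓ → Set
  CaseA j₁ j₂ = (∀ S → ¬ 𝒯₂′ T j₁ j₂ S) ⊎ (∀ S → ¬ 𝒯₂″ T j₁ j₂ S)

  CaseB : Fin ℓ → Fin ℓ → Set
  CaseB j₁ j₂ = ∃[ j₃ ] ((∀ S → 𝒯₂′ T j₁ j₂ S ⇔ (S ≡ ⁅ j₁ ⁆ ∪ ⁅ j₃ ⁆))
                       × (∀ S → 𝒯₂″ T j₁ j₂ S ⇔ (S ≡ ⁅ j₂ ⁆ ∪ ⁅ j₃ ⁆)))

  cases-exclusive : ∀ j₁ j₂ → ¬ (CaseA j₁ j₂ × CaseB j₁ j₂)
  cases-exclusive j₁ j₂ (inj₁ 𝒯₂′-empty , j₃ , 𝒯₂′≡ , _) = 𝒯₂′-empty _ (Equivalence.from (𝒯₂′≡ _) refl)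
  cases-exclusive j₁ j₂ (inj₂ 𝒯₂″-empty , j₃ , _ , 𝒯₂″≡) = 𝒯₂″-empty _ (Equivalence.from (𝒯₂″≡ _) refl)

  case-a-or-b : ∀ j₁ j₂ → CaseA j₁ j₂ ⊎ CaseB j₁ j₂
  case-a-or-b j₁ j₂
    with any? (λ S → (j₁ ∈? S) ×-dec ¬? (j₂ ∈? S)) (𝒯 T 2)
       | any? (λ S → ¬? (j₁ ∈? S) ×-dec (j₂ ∈? S)) (𝒯 T 2)
  ... | no none′ | _ = inj₁ (inj₁ λ S (S∈𝒯₂ , in-j₁) → none′ (lose S∈𝒯₂ in-j₁))
  ... | yes _ | no none″ = inj₁ (inj₂ λ S (S∈𝒯₂ , in-j₂) → none″ (lose S∈𝒯₂ in-j₂))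
  ... | yes some′ | yes some″ with find some′ | find some″
  ... | S′ , S′∈𝒯₂ , j₁∈S′ , j₂∉S′ | S″ , S″∈𝒯₂ , j₁∉S″ , j₂∈S″
    with crossing-pairs (∈𝒯⇒Member S′∈𝒯₂) j₁∈S′ j₂∉S′ (∈𝒯⇒Member S″∈𝒯₂) j₁∉S″ j₂∈S″
  ... | j₃ , shape′ , shape″ =
    inj₂ (j₃ , only-instance (S′∈𝒯₂ , j₁∈S′ , j₂∉S′) (λ S (S∈𝒯₂ , j₁∈S , j₂∉S) → shape′ (∈𝒯⇒Member S∈𝒯₂) j₁∈S j₂∉S)
             , only-instance (S″∈𝒯₂ , j₁∉S″ , j₂∈S″) (λ S (S∈𝒯₂ , j₁∉S , j₂∈S) → shape″ (∈𝒯⇒Member S∈𝒯₂) j₁∉S j₂∈S))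

lemma16 : ∀ {m ℓ : ℕ} (T : Matrix m ℓ)
    → (∀ (i i′ : Fin (suc m)) → i ≢ i′ → d (T i) (T i′) ≤ 3)
    → 5 ≤ length (𝒯 T 3)
    → ∃[ j₁ ] ∃[ j₂ ] (j₁ ≢ j₂
        × (∀ T₁ → T₁ ∈ 𝒯 T 1 → T₁ ⊆ (⁅ j₁ ⁆ ∪ ⁅ j₂ ⁆))
        × (∀ T₂ → T₂ ∈ 𝒯 T 2 → Nonempty (T₂ ∩ (⁅ j₁ ⁆ ∪ ⁅ j₂ ⁆)))
        × (∀ T₃ → T₃ ∈ 𝒯 T 3 → (⁅ j₁ ⁆ ∪ ⁅ j₂ ⁆) ⊆ T₃)
        × (let A = (∀ S → ¬ 𝒯₂′ T j₁ j₂ S) ⊎ (∀ S → ¬ 𝒯₂″ T j₁ j₂ S)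
               B = ∃[ j₃ ] ((∀ S → 𝒯₂′ T j₁ j₂ S ⇔ (S ≡ ⁅ j₁ ⁆ ∪ ⁅ j₃ ⁆))
                          × (∀ S → 𝒯₂″ T j₁ j₂ S ⇔ (S ≡ ⁅ j₂ ⁆ ∪ ⁅ j₃ ⁆)))
           in (A ⊎ B) × ¬ (A × B)))
lemma16 T rows-close five-in-𝒯₃ =
  let (j₁ , j₂ , j₁≢j₂ , K≡j₁j₂) = K-is-pair in
  j₁ , j₂ , j₁≢j₂ ,
  (λ S S∈𝒯₁ → subst (S ⊆_) K≡j₁j₂ (singleton⊆K (∈𝒯⇒Member S∈𝒯₁))) ,
  (λ S S∈𝒯₂ → subst (λ X → Nonempty (S ∩ X)) K≡j₁j₂ (pair-meets-K (∈𝒯⇒Member S∈𝒯₂))) ,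
  (λ S S∈𝒯₃ → subst (_⊆ S) K≡j₁j₂ (K⊆triple (∈𝒯⇒Member S∈𝒯₃))) ,
  case-a-or-b j₁ j₂ , cases-exclusive j₁ j₂
  where
  open RowDifferences T rows-close
  open Sunflower (five-triples (𝒯 T 3) ∈𝒯⇒Member (deduplicate-! _≟ₛ_ _) five-in-𝒯₃)
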